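{- Let $m,k\in\mathbb{N}$ with $k\le m$. The VC-dimension of the edge relation in the Johnson graph $J(m,k)$ is exactly $4$ if and only if $1<k<m-1$ and $|V(J(m,k))|=\binom{m}{k}\ge 16$.
   Context: For $m\ge k$ and a set $X$ with $|X|=m$, the Johnson graph $J(m,k)$ has vertex set $\binom{X}{k}$, two vertices being adjacent iff their intersection has size $k-1$. For a graph $G$, $N(v)$ denotes the open neighbourhood of $v$. The set system of the edge relation on $G$ is $(V(G),\{N(v):v\in V(G)\})$. A set $A\subseteq V(G)$ is shattered if $\{A\cap N(v): v\in V(G)\}$ is the full power set of $A$; the VC-dimension of the edge relation on $G$ is the supremum of the sizes of shattered sets. -}

module Defs where

open import Level using (Level; _⊔_) renaming (suc to lsuc)
open import Data.Nat using (ℕ; suc; _≤_)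
open import Data.Bool using (Bool; true)
open import Data.Fin using (Fin)
open import Data.Fin.Subset using (Subset; _∩_; ∣_∣)
open import Data.List using (List; length; lookup)
open import Data.List.Relation.Unary.Unique.Propositional using (Unique)
open import Data.Product using (Σ; ∃; _×_)
open import Function.Bundles using (_⇔_)
open import Relation.Binary.PropositionalEquality using (_≡_)

record Graph (a ℓ : Level) : Set (lsuc (a ⊔ ℓ)) where
  field
    V   : Set a
    Adj : V → V → Set ℓ

open Graph public

-- Johnson graph J(m,k): ground set X = Fin m, vertices the k-subsets of X,
-- u ~ v iff |u ∩ v| = k - 1  (written as 1 + |u ∩ v| = k, so that for k = 0
-- there are no edges, as k - 1 = -1 is not a cardinality).
JVertex : ℕ → ℕ → Set
JVertex m k = Σ (Subset m) (λ p → ∣ p ∣ ≡ k)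

Johnson : ℕ → ℕ → Graph _ _
Johnson m k = record
  { V   = JVertex m k
  ; Adj = λ u v → suc ∣ Σ.proj₁ u ∩ Σ.proj₁ v ∣ ≡ k
  }

-- A finite set A ⊆ V(G) is given as a duplicate-free list; |A| = length.
-- A is shattered by the neighbourhoods if every subset B of A (given as a
-- characteristic function on the positions of A) equals A ∩ N(v) for some v.
Shattered : ∀ {a ℓ} (G : Graph a ℓ) → List (V G) → Set (a ⊔ ℓ)
Shattered G A =
  Unique A ×
  ((B : Fin (length A) → Bool) →
     ∃ λ v → (i : Fin (length A)) → (Adj G v (lookup A i) ⇔ (B i ≡ true)))

VCdimEq : ∀ {a ℓ} (G : Graph a ℓ) → ℕ → Set (a ⊔ ℓ)
VCdimEq G d =
  (∃ λ A → Shattered G A × length A ≡ d) ×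
  ((A : List (V G)) → Shattered G A → length A ≤ d)

-- A set shattered by the neighbourhoods of J(m,k) has a common neighbour w, and every neighbour
-- of w is w ─ {x} ∪ {y} with x ∈ w and y ∉ w: a point (x , y) of a grid. A vertex z is adjacent
-- to w ─ {x} ∪ {y} iff [x ∉ z] + [y ∈ z] = |w ─ z|, so the trace of z on such points is all of
-- them, a cross (a row plus a column, minus their crossing), a 2 × 2 box, or nothing. Five
-- distinct grid points cannot have all their 4-subsets and a 3-subset as such traces, so the
-- VC-dimension is at most 4. Shattering four points needs 2⁴ distinct witnesses, so C(m,k) ≥ 16,
-- and k ∈ {0, 1, m − 1, m} is excluded because J(m,k) is then edgeless or complete. Conversely,
-- J(6,3), J(7,2) and J(7,5) shatter explicit 4-sets, and padding every vertex with the same new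
-- elements carries these into every other such J(m,k) with at least 16 vertices.

module Submission where

open import Level using (Level; _⊔_)
open import Data.Bool as Bool using (Bool; true; false; not; _∧_; _xor_; if_then_else_)
open import Data.Bool.Properties using (∧-comm; ∧-identityʳ; xor-comm; not-involutive)
open import Data.Empty using (⊥; ⊥-elim)
open import Data.Fin as Fin using (Fin; zero; suc; _↑ˡ_; splitAt)
open import Data.Fin.Patterns using (0F; 1F; 2F; 3F; 4F)
open import Data.Fin.Properties using (splitAt-↑ˡ; cast-involutive; all?)
open import Data.Fin.Subset as Subset using (Subset; _∩_; ∣_∣)
open import Data.Fin.Subset.Properties using (∩-comm; ∩-idem; ∣⊤∣≡n; ∣⊥∣≡0)
open import Data.List as List using (List; []; _∷_)
open import Data.List.Membership.Propositional using (_∈_)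
open import Data.List.Membership.Propositional.Properties using (∈-filter⁺; ∈-map⁺; ∈-++⁺ˡ; ∈-++⁺ʳ)
open import Data.List.Properties using (length-tabulate; lookup-tabulate; length-map; length-++)
import Data.List.Relation.Unary.All as All
open import Data.List.Relation.Unary.All using ([]; _∷_)
open import Data.List.Relation.Unary.AllPairs using ([]; _∷_)
import Data.List.Relation.Unary.Any as Any
open import Data.List.Relation.Unary.Any using (here; there)
open import Data.List.Relation.Unary.Any.Properties using (lookup-index)
open import Data.List.Relation.Unary.Unique.Propositional using (Unique)
import Data.List.Relation.Unary.Unique.DecPropositional as UniqueDec
open import Data.Nat as ℕ using (ℕ; zero; suc; _+_; _∸_; _^_; _≤_; _<_; z≤n; s≤s; s≤s⁻¹)
open import Data.Nat.Combinatorics using (_C_; nCk+nC[k+1]≡[n+1]C[k+1])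
open import Data.Nat.Properties
open import Algebra.Properties.CommutativeMonoid.Sum +-0-commutativeMonoid
  using (sum; sum-cong-≗; ∑-distrib-+)
open import Data.Product using (Σ; ∃; _×_; _,_; proj₁; proj₂)
open import Data.Sum as Sum using (_⊎_; inj₁; inj₂; [_,_]′)
open import Data.Vec as Vec using (Vec; []; _∷_)
open import Data.Vec.Properties
  using (lookup-zipWith; tabulate∘lookup; tabulate-cong; lookup∘tabulate; zipWith-++)
open import Function using (_∘_; _⇔_; mk⇔; Equivalence; case_of_)
open import Function.Construct.Composition using (_⇔-∘_)
open import Relation.Binary.PropositionalEquality
open import Relation.Nullary using (¬_; Dec; yes; no; does; ¬?; contradiction)
open import Relation.Nullary.Decidable using (True; toWitness; from-no)

open import Defs

private
  variable
    m n k : ℕ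
    ℓᵥ ℓₑ ℓᵥ′ ℓₑ′ : Level

-- Counting

bit : Bool → ℕ
bit true  = 1
bit false = 0

count : (Fin n → Bool) → ℕ
count f = sum (bit ∘ f)

_==_ : Fin n → Fin n → Bool
i == j = does (i Fin.≟ j)

==-refl : (i : Fin n) → (i == i) ≡ true
==-refl i with i Fin.≟ i
... | yes _  = refl
... | no i≢i = ⊥-elim (i≢i refl)

==⇒≡ : {i j : Fin n} → (i == j) ≡ true → i ≡ j
==⇒≡ {i = i} {j} eq with i Fin.≟ j
... | yes i≡j = i≡j

==-suc : (i j : Fin n) → (suc i == suc j) ≡ (i == j)
==-suc i j with i Fin.≟ j
... | yes _ = refl
... | no  _ = refl

≢⇒==false : {i j : Fin n} → i ≢ j → (i == j) ≡ false
≢⇒==false {i = i} {j} i≢j with i Fin.≟ j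
... | yes i≡j = ⊥-elim (i≢j i≡j)
... | no _    = refl

sum-mono-≤ : {f g : Fin n → ℕ} → (∀ i → f i ≤ g i) → sum f ≤ sum g
sum-mono-≤ {zero}  f≤g = z≤n
sum-mono-≤ {suc n} f≤g = +-mono-≤ (f≤g zero) (sum-mono-≤ (f≤g ∘ suc))

sum≡0⇒≡0 : (f : Fin n → ℕ) → sum f ≡ 0 → ∀ i → f i ≡ 0
sum≡0⇒≡0 f eq zero    = m+n≡0⇒m≡0 (f zero) eq
sum≡0⇒≡0 f eq (suc i) = sum≡0⇒≡0 (f ∘ suc) (m+n≡0⇒n≡0 (f zero) eq) i

sum-indicator : (x : Fin n) (c : ℕ) → sum (λ i → if i == x then c else 0) ≡ c
sum-indicator {suc n} zero c = trans (cong (c +_) (sum-zero n)) (+-identityʳ c)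
  where
  sum-zero : ∀ n → sum {n} (λ _ → 0) ≡ 0
  sum-zero zero    = refl
  sum-zero (suc n) = sum-zero n
sum-indicator {suc n} (suc x) c =
  trans (sum-cong-≗ (λ i → cong (if_then c else 0) (==-suc i x))) (sum-indicator x c)

∣p∣≡count : (p : Subset n) → ∣ p ∣ ≡ count (Vec.lookup p)
∣p∣≡count []          = refl
∣p∣≡count (true ∷ p)  = cong suc (∣p∣≡count p)
∣p∣≡count (false ∷ p) = ∣p∣≡count p

∣p∩q∣≡count : (p q : Subset n) → ∣ p ∩ q ∣ ≡ count (λ i → Vec.lookup p i ∧ Vec.lookup q i)
∣p∩q∣≡count p q = trans (∣p∣≡count (p ∩ q)) (sum-cong-≗ (λ i → cong bit (lookup-zipWith _∧_ i p q)))

count-partition : (f g : Fin n → Bool) → count f ≡ count (λ i → f i ∧ g i) + count (λ i → f i ∧ not (g i))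
count-partition f g =
  trans (sum-cong-≗ (λ i → split (f i) (g i))) (∑-distrib-+ (λ i → bit (f i ∧ g i)) (λ i → bit (f i ∧ not (g i))))
  where
  split : ∀ a b → bit a ≡ bit (a ∧ b) + bit (a ∧ not b)
  split true  true  = refl
  split true  false = refl
  split false _     = refl

count-∧-comm : (f g : Fin n → Bool) → count (λ i → f i ∧ g i) ≡ count (λ i → g i ∧ f i)
count-∧-comm f g = sum-cong-≗ (λ i → cong bit (∧-comm (f i) (g i)))

count≡0⇒≡false : (f : Fin n → Bool) → count f ≡ 0 → ∀ i → f i ≡ false
count≡0⇒≡false f eq i with f i | sum≡0⇒≡0 (bit ∘ f) eq i
... | false | _ = refl

count≡1⇒singleton : (f : Fin n → Bool) → count f ≡ 1 → ∃ λ x → ∀ i → f i ≡ (i == x)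
count≡1⇒singleton {suc n} f eq with f zero in f₀
... | true  = zero , λ where
  zero    → f₀
  (suc i) → count≡0⇒≡false (f ∘ suc) (suc-injective eq) i
... | false with count≡1⇒singleton (f ∘ suc) eq
... | x , f≗x = suc x , λ where
  zero    → f₀
  (suc i) → trans (f≗x i) (sym (==-suc i x))

∧-true : {b c : Bool} → (b ∧ c) ≡ true → b ≡ true × c ≡ true
∧-true {true} {true} _ = refl , refl

xor-true : {b c : Bool} → (b xor c) ≡ true → (b ≡ true × c ≡ false) ⊎ (b ≡ false × c ≡ true)
xor-true {true}  {false} _ = inj₁ (refl , refl)
xor-true {false} {true}  _ = inj₂ (refl , refl)

⇔-true⇒≡ : {P : Set} {b c : Bool} → P ⇔ (b ≡ true) → P ⇔ (c ≡ true) → b ≡ c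
⇔-true⇒≡ {b = true}  {true}  _   _   = refl
⇔-true⇒≡ {b = false} {false} _   _   = refl
⇔-true⇒≡ {b = true}  {false} P⇔b P⇔c = sym (Equivalence.to P⇔c (Equivalence.from P⇔b refl))
⇔-true⇒≡ {b = false} {true}  P⇔b P⇔c = Equivalence.to P⇔b (Equivalence.from P⇔c refl)

bit+bit≡1⇔xor : (b c : Bool) → (bit b + bit c ≡ 1) ⇔ ((b xor c) ≡ true)
bit+bit≡1⇔xor true  true  = mk⇔ (λ ()) (λ ())
bit+bit≡1⇔xor true  false = mk⇔ (λ _ → refl) (λ _ → refl)
bit+bit≡1⇔xor false true  = mk⇔ (λ _ → refl) (λ _ → refl)
bit+bit≡1⇔xor false false = mk⇔ (λ ()) (λ ())

bit+bit≡2⇔∧ : (b c : Bool) → (bit b + bit c ≡ 2) ⇔ ((b ∧ c) ≡ true)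
bit+bit≡2⇔∧ true  true  = mk⇔ (λ _ → refl) (λ _ → refl)
bit+bit≡2⇔∧ true  false = mk⇔ (λ ()) (λ ())
bit+bit≡2⇔∧ false true  = mk⇔ (λ ()) (λ ())
bit+bit≡2⇔∧ false false = mk⇔ (λ ()) (λ ())

bit+bit≤2 : (b c : Bool) → bit b + bit c ≤ 2
bit+bit≤2 true  true  = ≤-refl
bit+bit≤2 true  false = s≤s z≤n
bit+bit≤2 false true  = s≤s z≤n
bit+bit≤2 false false = z≤n

does⇔ : {P : Set ℓᵥ} (P? : Dec P) {b : Bool} → does P? ≡ b → P ⇔ (b ≡ true)
does⇔ (yes p) refl = mk⇔ (λ _ → refl) (λ _ → p)
does⇔ (no ¬p) refl = mk⇔ (λ p → ⊥-elim (¬p p)) (λ ())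

bit-trade : ∀ A c b b′ → A + bit b ≡ c + bit b′ → suc A ≡ c + (bit (not b) + bit b′)
bit-trade A c true  b′    eq = trans (+-comm 1 A) eq
bit-trade A c false true  eq = trans (cong suc (trans (sym (+-identityʳ A)) eq)) (sym (+-suc c 1))
bit-trade A c false false eq = trans (cong suc (trans (sym (+-identityʳ A)) (trans eq (+-identityʳ c)))) (+-comm 1 c)

AtMostTwo : (Fin n → Bool) → Set
AtMostTwo f = ∀ a b c → f a ≡ true → f b ≡ true → f c ≡ true → a ≢ b → a ≡ c ⊎ b ≡ c

3≤count : (f : Fin n → Bool) {a b c : Fin n} → f a ≡ true → f b ≡ true → f c ≡ true →
          a ≢ b → a ≢ c → b ≢ c → 3 ≤ count f
3≤count f {a} {b} {c} fa fb fc a≢b a≢c b≢c = begin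
  3                                  ≡⟨ cong₂ _+_ (cong₂ _+_ (sum-indicator a 1) (sum-indicator b 1)) (sum-indicator c 1) ⟨
  sum (δ a) + sum (δ b) + sum (δ c)  ≡⟨ cong (_+ sum (δ c)) (∑-distrib-+ (δ a) (δ b)) ⟨
  sum (λ i → δ a i + δ b i) + sum (δ c) ≡⟨ ∑-distrib-+ (λ i → δ a i + δ b i) (δ c) ⟨
  sum (λ i → δ a i + δ b i + δ c i)  ≤⟨ sum-mono-≤ pointwise ⟩
  count f                            ∎
  where
  open ≤-Reasoning
  δ : Fin _ → Fin _ → ℕ
  δ x i = if i == x then 1 else 0
  pointwise : ∀ i → δ a i + δ b i + δ c i ≤ bit (f i)
  pointwise i with i Fin.≟ a | i Fin.≟ b | i Fin.≟ c
  ... | no _     | no _     | no _     = z≤n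
  ... | yes refl | no _     | no _     rewrite fa = ≤-refl
  ... | no _     | yes refl | no _     rewrite fb = ≤-refl
  ... | no _     | no _     | yes refl rewrite fc = ≤-refl
  ... | yes refl | yes refl | _        = ⊥-elim (a≢b refl)
  ... | yes refl | _        | yes refl = ⊥-elim (a≢c refl)
  ... | _        | yes refl | yes refl = ⊥-elim (b≢c refl)

count≡2⇒AtMostTwo : (f : Fin n → Bool) → count f ≡ 2 → AtMostTwo f
count≡2⇒AtMostTwo f eq a b c fa fb fc a≢b with a Fin.≟ c | b Fin.≟ c
... | yes a≡c | _       = inj₁ a≡c
... | no _    | yes b≡c = inj₂ b≡c
... | no a≢c  | no b≢c  = ⊥-elim (<-irrefl (sym eq) (3≤count f fa fb fc a≢b a≢c b≢c))

-- Shattering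

-- Shattered G A unfolds to Unique A × Shatters G (List.lookup A).
Shatters : (G : Graph ℓᵥ ℓₑ) → (Fin n → V G) → Set (ℓᵥ ⊔ ℓₑ)
Shatters G p = (B : Fin _ → Bool) → ∃ λ v → ∀ i → Adj G v (p i) ⇔ (B i ≡ true)

module _ (G : Graph ℓᵥ ℓₑ) where

  shatters-injective : {p : Fin n → V G} → Shatters G p → ∀ {i j} → i ≢ j → p i ≢ p j
  shatters-injective {p = p} shatters {i} {j} i≢j pᵢ≡pⱼ =
    i≢j (sym (==⇒≡ (Equivalence.to (v~p⇔B j) (subst (Adj G v) pᵢ≡pⱼ (Equivalence.from (v~p⇔B i) (==-refl i))))))
    where
    v = proj₁ (shatters (_== i))
    v~p⇔B = proj₂ (shatters (_== i))

  shatters-tail : {p : Fin (suc n) → V G} → Shatters G p → Shatters G (p ∘ suc)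
  shatters-tail shatters B = proj₁ (shatters B⁺) , proj₂ (shatters B⁺) ∘ suc
    where
    B⁺ : Fin (suc _) → Bool
    B⁺ zero    = false
    B⁺ (suc i) = B i

  shatters-↑ˡ : {p : Fin (k + n) → V G} → Shatters G p → Shatters G (p ∘ (_↑ˡ n))
  shatters-↑ˡ {k = k} {n} shatters B = v , λ i →
    subst (λ b → Adj G v _ ⇔ (b ≡ true)) (cong [ B , (λ _ → false) ]′ (splitAt-↑ˡ k i n)) (v~p⇔B (i ↑ˡ n))
    where
    B⁺ = [ B , (λ _ → false) ]′ ∘ splitAt k
    v = proj₁ (shatters B⁺)
    v~p⇔B = proj₂ (shatters B⁺)

  shatters⇒Unique : (A : List (V G)) → Shatters G (List.lookup A) → Unique A
  shatters⇒Unique []       _        = []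
  shatters⇒Unique (x ∷ xs) shatters =
    All.tabulate (λ x∈xs x≡y →
      shatters-injective shatters {zero} {suc (Any.index x∈xs)} (λ ()) (trans x≡y (lookup-index x∈xs)))
    ∷ shatters⇒Unique xs (shatters-tail shatters)

  shatters⇒Shattered : (A : List (V G)) → Shatters G (List.lookup A) → Shattered G A
  shatters⇒Shattered A shatters = shatters⇒Unique A shatters , shatters

  shatters⇒Shattered-tabulate : (p : Fin n → V G) → Shatters G p → Shattered G (List.tabulate p)
  shatters⇒Shattered-tabulate p shatters = shatters⇒Shattered (List.tabulate p) λ B →
    let v , v~p⇔B = shatters (B ∘ Fin.cast (sym ∣p∣≡n)) in
    v , λ j → subst (λ j′ → Adj G v (List.lookup (List.tabulate p) j′) ⇔ (B j′ ≡ true))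
                    (cast-involutive (sym ∣p∣≡n) ∣p∣≡n j)
                    (subst (λ u → Adj G v u ⇔ (B (Fin.cast (sym ∣p∣≡n) (Fin.cast ∣p∣≡n j)) ≡ true))
                           (sym (lookup-tabulate p (Fin.cast ∣p∣≡n j))) (v~p⇔B (Fin.cast ∣p∣≡n j)))
    where ∣p∣≡n = length-tabulate p

  edgeless-shatters-nothing : (∀ u v → ¬ Adj G u v) → {p : Fin (suc n) → V G} → ¬ Shatters G p
  edgeless-shatters-nothing no-edge {p} shatters =
    no-edge v (p zero) (Equivalence.from (v~p⇔B zero) refl)
    where
    v = proj₁ (shatters (λ _ → true))
    v~p⇔B = proj₂ (shatters (λ _ → true))

  complete-shatters-at-most-one : (∀ u v → ¬ Adj G u v → u ≡ v) → {p : Fin (suc (suc n)) → V G} → ¬ Shatters G p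
  complete-shatters-at-most-one complete {p} shatters =
    shatters-injective shatters {0F} {1F} (λ ()) (trans (sym (complete v (p 0F) (non-adjacent 0F))) (complete v (p 1F) (non-adjacent 1F)))
    where
    v = proj₁ (shatters (λ _ → false))
    non-adjacent : ∀ i → ¬ Adj G v (p i)
    non-adjacent i adj with Equivalence.to (proj₂ (shatters (λ _ → false)) i) adj
    ... | ()

module _ {H : Graph ℓᵥ ℓₑ} {G : Graph ℓᵥ′ ℓₑ′} (f : V H → V G)
         (f-adj : ∀ u v → Adj G (f u) (f v) ⇔ Adj H u v) where

  shatters-embed : {p : Fin n → V H} → Shatters H p → Shatters G (f ∘ p)
  shatters-embed {p = p} shatters B = f v , λ i → v~p⇔B i ⇔-∘ f-adj v (p i)
    where
    v = proj₁ (shatters B)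
    v~p⇔B = proj₂ (shatters B)

length-filter+length-filter-¬ : {A : Set ℓᵥ} {P : A → Set ℓₑ} (P? : (x : A) → Dec (P x)) (xs : List A) →
  List.length (List.filter P? xs) + List.length (List.filter (¬? ∘ P?) xs) ≡ List.length xs
length-filter+length-filter-¬ P? []       = refl
length-filter+length-filter-¬ P? (x ∷ xs) with P? x
... | yes _ = cong suc (length-filter+length-filter-¬ P? xs)
... | no  _ = trans (+-suc _ _) (cong suc (length-filter+length-filter-¬ P? xs))

-- The candidates adjacent to the first point, and those not adjacent to it, each realise all
-- patterns on the remaining points.
realising-all-patterns⇒2^n≤length : {A : Set ℓᵥ} {R : A → Fin n → Set ℓₑ} →
  (∀ v i → Dec (R v i)) → (vs : List A) →
  (∀ (B : Fin n → Bool) → ∃ λ v → v ∈ vs × ∀ i → R v i ⇔ (B i ≡ true)) →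
  2 ^ n ≤ List.length vs
realising-all-patterns⇒2^n≤length {n = zero} R? vs realised with realised (λ ())
... | _ , here _ , _ = s≤s z≤n
... | _ , there _ , _ = s≤s z≤n
realising-all-patterns⇒2^n≤length {n = suc n} {R = R} R? vs realised = begin
  2 ^ n + (2 ^ n + 0)        ≡⟨ cong (2 ^ n +_) (+-identityʳ (2 ^ n)) ⟩
  2 ^ n + 2 ^ n              ≤⟨ +-mono-≤ (count-half true) (count-half false) ⟩
  List.length (List.filter (λ v → R? v zero) vs) + List.length (List.filter (¬? ∘ (λ v → R? v zero)) vs)
                             ≡⟨ length-filter+length-filter-¬ (λ v → R? v zero) vs ⟩
  List.length vs             ∎
  where
  open ≤-Reasoning
  half : Bool → List _
  half true  = List.filter (λ v → R? v zero) vs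
  half false = List.filter (¬? ∘ (λ v → R? v zero)) vs
  count-half : ∀ b → 2 ^ n ≤ List.length (half b)
  count-half b = realising-all-patterns⇒2^n≤length (λ v i → R? v (suc i)) (half b) λ B →
    let v , v∈vs , v~B = realised (λ { zero → b ; (suc i) → B i }) in
    v , in-half b (Equivalence.to (v~B zero)) (Equivalence.from (v~B zero)) v∈vs , v~B ∘ suc
    where
    in-half : ∀ b {v} → (R v zero → b ≡ true) → (b ≡ true → R v zero) → v ∈ vs → v ∈ half b
    in-half true  _  b⇒R v∈vs = ∈-filter⁺ (λ v → R? v zero) v∈vs (b⇒R refl)
    in-half false R⇒b _ v∈vs = ∈-filter⁺ (¬? ∘ (λ v → R? v zero)) v∈vs (λ r → case R⇒b r of λ ())

allPatterns : (n : ℕ) → List (Vec Bool n)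
allPatterns zero    = [] ∷ []
allPatterns (suc n) = List.map (true ∷_) (allPatterns n) List.++ List.map (false ∷_) (allPatterns n)

∈-allPatterns : (bs : Vec Bool n) → bs ∈ allPatterns n
∈-allPatterns []           = here refl
∈-allPatterns (true ∷ bs)  = ∈-++⁺ˡ (∈-map⁺ (true ∷_) (∈-allPatterns bs))
∈-allPatterns (false ∷ bs) = ∈-++⁺ʳ _ (∈-map⁺ (false ∷_) (∈-allPatterns bs))

module _ (G : Graph ℓᵥ ℓₑ) (adj? : ∀ u v → Dec (Adj G u v)) (candidates : List (V G)) (p : Fin n → V G) where

  Cuts : Vec Bool n → V G → Set
  Cuts bs v = ∀ i → does (adj? v (p i)) ≡ Vec.lookup bs i

  search? : Dec (All.All (λ bs → Any.Any (Cuts bs) candidates) (allPatterns n))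
  search? = All.all? (λ bs → Any.any? (λ v → all? λ i → does (adj? v (p i)) Bool.≟ Vec.lookup bs i) candidates) (allPatterns n)

  shatters-by-search : All.All (λ bs → Any.Any (Cuts bs) candidates) (allPatterns n) → Shatters G p
  shatters-by-search found B =
    let v , v-cuts = Any.satisfied (All.lookup found (∈-allPatterns (Vec.tabulate B))) in
    v , λ i → does⇔ (adj? v (p i)) (trans (v-cuts i) (lookup∘tabulate B i))

-- Johnson graphs

χ : JVertex m k → Fin m → Bool
χ u = Vec.lookup (proj₁ u)

count-χ : (u : JVertex m k) → count (χ u) ≡ k
count-χ (p , ∣p∣≡k) = trans (sym (∣p∣≡count p)) ∣p∣≡k

∣u∩v∣≡count : (u v : JVertex m k) → ∣ proj₁ u ∩ proj₁ v ∣ ≡ count (λ x → χ u x ∧ χ v x)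
∣u∩v∣≡count u v = ∣p∩q∣≡count (proj₁ u) (proj₁ v)

χ-injective : (u v : JVertex m k) → (∀ x → χ u x ≡ χ v x) → u ≡ v
χ-injective (p , ∣p∣≡k) (q , ∣q∣≡k) χu≗χv
  with trans (sym (tabulate∘lookup p)) (trans (tabulate-cong χu≗χv) (tabulate∘lookup q))
... | refl = cong (p ,_) (≡-irrelevant ∣p∣≡k ∣q∣≡k)

count-χ-partition : (u v : JVertex m k) →
  ∣ proj₁ u ∩ proj₁ v ∣ + count (λ x → χ u x ∧ not (χ v x)) ≡ k
count-χ-partition {k = k} u v = begin
  ∣ proj₁ u ∩ proj₁ v ∣ + count (λ x → χ u x ∧ not (χ v x))           ≡⟨ cong (_+ count (λ x → χ u x ∧ not (χ v x))) (∣u∩v∣≡count u v) ⟩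
  count (λ x → χ u x ∧ χ v x) + count (λ x → χ u x ∧ not (χ v x)) ≡⟨ count-partition (χ u) (χ v) ⟨
  count (χ u)                                                       ≡⟨ count-χ u ⟩
  k                                                                 ∎
  where open ≡-Reasoning

k≤∣u∩v∣⇒≡ : (u v : JVertex m k) → k ≤ ∣ proj₁ u ∩ proj₁ v ∣ → u ≡ v
k≤∣u∩v∣⇒≡ {k = k} u v k≤∣u∩v∣ = χ-injective u v λ x →
  ⊆-antisym (count≡0⇒≡false _ (difference≡0 u v k≤∣u∩v∣) x)
            (count≡0⇒≡false _ (difference≡0 v u (subst (k ≤_) (∣u∩v∣≡∣v∩u∣ u v) k≤∣u∩v∣)) x)
  where
  difference≡0 : (u v : JVertex m k) → k ≤ ∣ proj₁ u ∩ proj₁ v ∣ → count (λ x → χ u x ∧ not (χ v x)) ≡ 0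
  difference≡0 u v le = n≤0⇒n≡0 (+-cancelˡ-≤ _ _ 0 (begin
    ∣ proj₁ u ∩ proj₁ v ∣ + count (λ x → χ u x ∧ not (χ v x)) ≡⟨ count-χ-partition u v ⟩
    k                                                         ≤⟨ le ⟩
    ∣ proj₁ u ∩ proj₁ v ∣                                     ≡⟨ +-identityʳ _ ⟨
    ∣ proj₁ u ∩ proj₁ v ∣ + 0                                 ∎))
    where open ≤-Reasoning
  ∣u∩v∣≡∣v∩u∣ : (u v : JVertex m k) → ∣ proj₁ u ∩ proj₁ v ∣ ≡ ∣ proj₁ v ∩ proj₁ u ∣
  ∣u∩v∣≡∣v∩u∣ u v = cong ∣_∣ (∩-comm (proj₁ u) (proj₁ v))
  ⊆-antisym : ∀ {a b} → (a ∧ not b) ≡ false → (b ∧ not a) ≡ false → a ≡ b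
  ⊆-antisym {true}  {true}  _ _ = refl
  ⊆-antisym {false} {false} _ _ = refl

count-true : (n : ℕ) → count {n} (λ _ → true) ≡ n
count-true zero    = refl
count-true (suc n) = cong suc (count-true n)

k+k≤∣u∩v∣+m : (u v : JVertex m k) → k + k ≤ ∣ proj₁ u ∩ proj₁ v ∣ + m
k+k≤∣u∩v∣+m {m} {k} u v = begin
  k + k                                           ≡⟨ cong₂ _+_ (count-χ u) (count-χ v) ⟨
  count (χ u) + count (χ v)                       ≡⟨ ∑-distrib-+ (bit ∘ χ u) (bit ∘ χ v) ⟨
  sum (λ x → bit (χ u x) + bit (χ v x))           ≤⟨ sum-mono-≤ (λ x → pointwise (χ u x) (χ v x)) ⟩
  sum (λ x → bit (χ u x ∧ χ v x) + 1)             ≡⟨ ∑-distrib-+ (λ x → bit (χ u x ∧ χ v x)) (λ _ → 1) ⟩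
  count (λ x → χ u x ∧ χ v x) + count {m} (λ _ → true) ≡⟨ cong₂ _+_ (sym (∣u∩v∣≡count u v)) (count-true m) ⟩
  ∣ proj₁ u ∩ proj₁ v ∣ + m                       ∎
  where
  open ≤-Reasoning
  pointwise : ∀ a b → bit a + bit b ≤ bit (a ∧ b) + 1
  pointwise true  true  = ≤-refl
  pointwise true  false = ≤-refl
  pointwise false true  = ≤-refl
  pointwise false false = z≤n

Johnson-k≡m-edgeless : k ≡ m → (u v : JVertex m k) → ¬ Adj (Johnson m k) u v
Johnson-k≡m-edgeless {m = m} refl u v adj = 1+n≰n (begin
  suc ∣ proj₁ u ∩ proj₁ v ∣ ≡⟨ adj ⟩
  m                         ≤⟨ +-cancelʳ-≤ m m _ (k+k≤∣u∩v∣+m u v) ⟩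
  ∣ proj₁ u ∩ proj₁ v ∣     ∎)
  where open ≤-Reasoning

k≤1+∣u∩v∣⇒non-adjacent⇒≡ : (u v : JVertex m k) → k ≤ suc ∣ proj₁ u ∩ proj₁ v ∣ →
                            ¬ Adj (Johnson m k) u v → u ≡ v
k≤1+∣u∩v∣⇒non-adjacent⇒≡ u v k≤1+∣u∩v∣ ¬adj with m≤n⇒m<n∨m≡n k≤1+∣u∩v∣
... | inj₁ k<1+∣u∩v∣ = k≤∣u∩v∣⇒≡ u v (s≤s⁻¹ k<1+∣u∩v∣)
... | inj₂ k≡1+∣u∩v∣ = ⊥-elim (¬adj (sym k≡1+∣u∩v∣))

Johnson-m-1-complete : (u v : JVertex m 1) → ¬ Adj (Johnson m 1) u v → u ≡ v
Johnson-m-1-complete u v = k≤1+∣u∩v∣⇒non-adjacent⇒≡ u v (s≤s z≤n)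

Johnson-1+k≡m-complete : suc k ≡ m → (u v : JVertex m k) → ¬ Adj (Johnson m k) u v → u ≡ v
Johnson-1+k≡m-complete {k} refl u v = k≤1+∣u∩v∣⇒non-adjacent⇒≡ u v
  (+-cancelʳ-≤ k k _ (subst (k + k ≤_) (+-suc _ k) (k+k≤∣u∩v∣+m u v)))

cons-inside : JVertex m k → JVertex (suc m) (suc k)
cons-inside (p , ∣p∣≡k) = true ∷ p , cong suc ∣p∣≡k

cons-outside : JVertex m k → JVertex (suc m) k
cons-outside (p , ∣p∣≡k) = false ∷ p , ∣p∣≡k

kSubsets : (m k : ℕ) → List (JVertex m k)
kSubsets zero    zero    = ([] , refl) ∷ []
kSubsets zero    (suc k) = []
kSubsets (suc m) zero    = List.map cons-outside (kSubsets m zero)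
kSubsets (suc m) (suc k) = List.map cons-inside (kSubsets m k) List.++ List.map cons-outside (kSubsets m (suc k))

∈-kSubsets : (u : JVertex m k) → u ∈ kSubsets m k
∈-kSubsets ([] , refl) = here refl
∈-kSubsets {k = zero}  (false ∷ p , ∣p∣≡0)   = ∈-map⁺ cons-outside (∈-kSubsets (p , ∣p∣≡0))
∈-kSubsets {k = suc k} (false ∷ p , ∣p∣≡1+k) = ∈-++⁺ʳ _ (∈-map⁺ cons-outside (∈-kSubsets (p , ∣p∣≡1+k)))
∈-kSubsets {k = suc k} (true ∷ p , refl)     = ∈-++⁺ˡ (∈-map⁺ cons-inside (∈-kSubsets (p , refl)))

length-kSubsets : (m k : ℕ) → List.length (kSubsets m k) ≡ m C k
length-kSubsets zero    zero    = refl
length-kSubsets zero    (suc k) = refl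
length-kSubsets (suc m) zero    = trans (length-map cons-outside (kSubsets m zero)) (length-kSubsets m zero)
length-kSubsets (suc m) (suc k) = begin
  List.length (List.map cons-inside (kSubsets m k) List.++ List.map cons-outside (kSubsets m (suc k)))
    ≡⟨ length-++ (List.map cons-inside (kSubsets m k)) ⟩
  List.length (List.map cons-inside (kSubsets m k)) + List.length (List.map cons-outside (kSubsets m (suc k)))
    ≡⟨ cong₂ _+_ (length-map cons-inside (kSubsets m k)) (length-map cons-outside (kSubsets m (suc k))) ⟩
  List.length (kSubsets m k) + List.length (kSubsets m (suc k))
    ≡⟨ cong₂ _+_ (length-kSubsets m k) (length-kSubsets m (suc k)) ⟩
  m C k + m C suc k
    ≡⟨ nCk+nC[k+1]≡[n+1]C[k+1] m k ⟩
  suc m C suc k ∎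
  where open ≡-Reasoning

Johnson-adj? : (u v : JVertex m k) → Dec (Adj (Johnson m k) u v)
Johnson-adj? u v = suc ∣ proj₁ u ∩ proj₁ v ∣ ℕ.≟ _

Johnson-shatters⇒2^n≤mCk : {p : Fin n → JVertex m k} → Shatters (Johnson m k) p → 2 ^ n ≤ m C k
Johnson-shatters⇒2^n≤mCk {m = m} {k} {p} shatters =
  subst (_ ≤_) (length-kSubsets m k)
    (realising-all-patterns⇒2^n≤length (λ v i → Johnson-adj? v (p i)) (kSubsets m k) λ B →
      let v , v~p⇔B = shatters B in v , ∈-kSubsets v , v~p⇔B)

∣p++q∣≡∣p∣+∣q∣ : {r : ℕ} (p : Subset n) (q : Subset r) → ∣ p Vec.++ q ∣ ≡ ∣ p ∣ + ∣ q ∣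
∣p++q∣≡∣p∣+∣q∣ []          q = refl
∣p++q∣≡∣p∣+∣q∣ (true ∷ p)  q = cong suc (∣p++q∣≡∣p∣+∣q∣ p q)
∣p++q∣≡∣p∣+∣q∣ (false ∷ p) q = ∣p++q∣≡∣p∣+∣q∣ p q

module _ {r t : ℕ} (e : Subset r) (∣e∣≡t : ∣ e ∣ ≡ t) where

  pad : JVertex n k → JVertex (n + r) (k + t)
  pad (p , ∣p∣≡k) = p Vec.++ e , trans (∣p++q∣≡∣p∣+∣q∣ p e) (cong₂ _+_ ∣p∣≡k ∣e∣≡t)

  pad-adj : (u v : JVertex n k) → Adj (Johnson (n + r) (k + t)) (pad u) (pad v) ⇔ Adj (Johnson n k) u v
  pad-adj (p , _) (q , _) = mk⇔ (λ adj → +-cancelʳ-≡ t _ _ (trans (cong suc (sym ∣∩∣)) adj))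
                                (λ adj → trans (cong suc ∣∩∣) (cong (_+ t) adj))
    where
    ∣∩∣ : ∣ (p Vec.++ e) ∩ (q Vec.++ e) ∣ ≡ ∣ p ∩ q ∣ + t
    ∣∩∣ = begin
      ∣ (p Vec.++ e) ∩ (q Vec.++ e) ∣ ≡⟨ cong ∣_∣ (zipWith-++ _∧_ p e q e) ⟩
      ∣ (p ∩ q) Vec.++ (e ∩ e) ∣     ≡⟨ ∣p++q∣≡∣p∣+∣q∣ (p ∩ q) (e ∩ e) ⟩
      ∣ p ∩ q ∣ + ∣ e ∩ e ∣           ≡⟨ cong (λ s → ∣ p ∩ q ∣ + ∣ s ∣) (∩-idem e) ⟩
      ∣ p ∩ q ∣ + ∣ e ∣               ≡⟨ cong (∣ p ∩ q ∣ +_) ∣e∣≡t ⟩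
      ∣ p ∩ q ∣ + t                   ∎
      where open ≡-Reasoning

-- Traces on the neighbourhood of a vertex

record Exchange (w a : JVertex m k) : Set where
  field
    removed added : Fin m
    removed∈w : χ w removed ≡ true
    removed∉a : χ a removed ≡ false
    added∉w   : χ w added ≡ false
    added∈a   : χ a added ≡ true
    unchanged : ∀ x → x ≢ removed → x ≢ added → χ a x ≡ χ w x

  removed≢added : removed ≢ added
  removed≢added r≡a with trans (sym removed∈w) (trans (cong (χ w) r≡a) added∉w)
  ... | ()

adjacent⇒exchange : (w a : JVertex m k) → Adj (Johnson m k) w a → Exchange w a
adjacent⇒exchange {k = k} w a adj = record
  { removed   = X
  ; added     = Y
  ; removed∈w = proj₁ (∧-true (trans (X-only X) (==-refl X)))
  ; removed∉a = not-true (proj₂ (∧-true (trans (X-only X) (==-refl X))))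
  ; added∉w   = not-true (proj₂ (∧-true (trans (Y-only Y) (==-refl Y))))
  ; added∈a   = proj₁ (∧-true (trans (Y-only Y) (==-refl Y)))
  ; unchanged = λ x x≢X x≢Y → agree (trans (X-only x) (≢⇒==false x≢X)) (trans (Y-only x) (≢⇒==false x≢Y))
  }
  where
  difference≡1 : (u v : JVertex _ k) → suc ∣ proj₁ u ∩ proj₁ v ∣ ≡ k → count (λ x → χ u x ∧ not (χ v x)) ≡ 1
  difference≡1 u v eq = +-cancelˡ-≡ ∣ proj₁ u ∩ proj₁ v ∣ _ 1 (trans (count-χ-partition u v) (trans (sym eq) (+-comm 1 _)))
  w─a = count≡1⇒singleton _ (difference≡1 w a adj)
  a─w = count≡1⇒singleton _ (difference≡1 a w (trans (cong (suc ∘ ∣_∣) (∩-comm (proj₁ a) (proj₁ w))) adj))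
  X = proj₁ w─a
  X-only = proj₂ w─a
  Y = proj₁ a─w
  Y-only = proj₂ a─w
  not-true : ∀ {b} → not b ≡ true → b ≡ false
  not-true {false} _ = refl
  agree : ∀ {b c} → (c ∧ not b) ≡ false → (b ∧ not c) ≡ false → b ≡ c
  agree {true}  {true}  _ _ = refl
  agree {false} {false} _ _ = refl

module _ {w a : JVertex m k} (e : Exchange w a) where
  open Exchange e

  exchange-overlap : (z : Fin m → Bool) →
    count (λ x → z x ∧ χ a x) + bit (z removed) ≡ count (λ x → z x ∧ χ w x) + bit (z added)
  exchange-overlap z = begin
    count (λ x → z x ∧ χ a x) + bit (z removed)
      ≡⟨ cong (count (λ x → z x ∧ χ a x) +_) (sum-indicator removed (bit (z removed))) ⟨
    count (λ x → z x ∧ χ a x) + sum (δ removed)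
      ≡⟨ ∑-distrib-+ (λ x → bit (z x ∧ χ a x)) (δ removed) ⟨
    sum (λ x → bit (z x ∧ χ a x) + δ removed x)
      ≡⟨ sum-cong-≗ pointwise ⟩
    sum (λ x → bit (z x ∧ χ w x) + δ added x)
      ≡⟨ ∑-distrib-+ (λ x → bit (z x ∧ χ w x)) (δ added) ⟩
    count (λ x → z x ∧ χ w x) + sum (δ added)
      ≡⟨ cong (count (λ x → z x ∧ χ w x) +_) (sum-indicator added (bit (z added))) ⟩
    count (λ x → z x ∧ χ w x) + bit (z added) ∎
    where
    open ≡-Reasoning
    δ : Fin m → Fin m → ℕ
    δ y x = if x == y then bit (z y) else 0
    pointwise : ∀ x → bit (z x ∧ χ a x) + δ removed x ≡ bit (z x ∧ χ w x) + δ added x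
    pointwise x with x Fin.≟ removed | x Fin.≟ added
    ... | yes refl | yes x≡added = ⊥-elim (removed≢added x≡added)
    ... | yes refl | no _  rewrite removed∉a | removed∈w with z x
    ...   | true  = refl
    ...   | false = refl
    pointwise x | no _ | yes refl rewrite added∈a | added∉w with z x
    ...   | true  = refl
    ...   | false = refl
    pointwise x | no x≢removed | no x≢added rewrite unchanged x x≢removed x≢added = refl

exchange-determined : {w a b : JVertex m k} (e : Exchange w a) (f : Exchange w b) →
  Exchange.removed e ≡ Exchange.removed f → Exchange.added e ≡ Exchange.added f → a ≡ b
exchange-determined {w = w} {a} {b} e f refl refl = χ-injective a b pointwise
  where
  module E = Exchange e
  module F = Exchange f
  pointwise : ∀ x → χ a x ≡ χ b x
  pointwise x with x Fin.≟ E.removed | x Fin.≟ E.added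
  ... | yes refl | _        = trans E.removed∉a (sym F.removed∉a)
  ... | no _     | yes refl = trans E.added∈a (sym F.added∈a)
  ... | no x≢r   | no x≢a   = trans (E.unchanged x x≢r x≢a) (sym (F.unchanged x x≢r x≢a))

-- The i-th neighbour of w is w ─ {x i} ∪ {y i}, drawn as the grid point (x i , y i); these are
-- the patterns a vertex z can cut out on such neighbours, for |w ─ z| = 0, 1, 2 and ≥ 3.
data GridTrace (x y : Fin n → Fin m) (B : Fin n → Bool) : Set where
  full  : (∀ i → B i ≡ true) → GridTrace x y B
  cross : (X Y : Fin m) → (∀ i → B i ≡ ((x i == X) xor (y i == Y))) → GridTrace x y B
  box   : (W Y : Fin m → Bool) → AtMostTwo W → AtMostTwo Y →
          (∀ i → B i ≡ (W (x i) ∧ Y (y i))) → GridTrace x y B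
  empty : (∀ i → B i ≡ false) → GridTrace x y B

level-set-is-GridTrace : (x y : Fin n → Fin m) (W Y : Fin m → Bool) (B : Fin n → Bool) →
  count Y ≡ count W → (∀ i → (bit (W (x i)) + bit (Y (y i)) ≡ count W) ⇔ (B i ≡ true)) →
  GridTrace x y B
level-set-is-GridTrace x y W Y B ∣Y∣≡∣W∣ level with count W in ∣W∣
... | 0 = full λ i → Equivalence.to (level i) (cong₂ (λ b c → bit b + bit c)
  (count≡0⇒≡false W ∣W∣ (x i)) (count≡0⇒≡false Y ∣Y∣≡∣W∣ (y i)))
... | 1 with count≡1⇒singleton W ∣W∣ | count≡1⇒singleton Y ∣Y∣≡∣W∣
...   | X , W≗X | Y′ , Y≗Y′ = cross X Y′ λ i → ⇔-true⇒≡ (level i)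
  (subst (λ t → (bit (W (x i)) + bit (Y (y i)) ≡ 1) ⇔ (t ≡ true))
         (cong₂ _xor_ (W≗X (x i)) (Y≗Y′ (y i))) (bit+bit≡1⇔xor (W (x i)) (Y (y i))))
level-set-is-GridTrace x y W Y B ∣Y∣≡∣W∣ level | 2 =
  box W Y (count≡2⇒AtMostTwo W ∣W∣) (count≡2⇒AtMostTwo Y ∣Y∣≡∣W∣)
      λ i → ⇔-true⇒≡ (level i) (bit+bit≡2⇔∧ (W (x i)) (Y (y i)))
level-set-is-GridTrace x y W Y B ∣Y∣≡∣W∣ level | suc (suc (suc s)) = empty λ i →
  ⇔-true⇒≡ (level i) (mk⇔ (λ eq → ⊥-elim (<⇒≱ (s≤s (s≤s (s≤s z≤n)))
                                               (subst (_≤ 2) eq (bit+bit≤2 (W (x i)) (Y (y i))))))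
                           λ ())

module _ {w : JVertex m k} {a : Fin n → JVertex m k} (e : ∀ i → Exchange w (a i)) where
  open Exchange

  -- With W = w ─ z and Y = z ─ w, z is adjacent to a i iff [removed ∈ W] + [added ∈ Y] = |W| = |Y|.
  trace-is-GridTrace : (z : JVertex m k) (B : Fin n → Bool) →
    (∀ i → Adj (Johnson m k) z (a i) ⇔ (B i ≡ true)) →
    GridTrace (removed ∘ e) (added ∘ e) B
  trace-is-GridTrace z B z~a⇔B =
    level-set-is-GridTrace (removed ∘ e) (added ∘ e) W Y B
      (+-cancelˡ-≡ c _ _ (trans ∣z∣ (sym ∣w∣)))
      λ i → z~a⇔B i ⇔-∘ mk⇔ (λ t≡∣W∣ → trans (key i) (trans (cong (c +_) t≡∣W∣) ∣w∣))
                             (λ adj → +-cancelˡ-≡ c _ _ (trans (sym (key i)) (trans adj (sym ∣w∣))))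
    where
    W Y : Fin m → Bool
    W p = χ w p ∧ not (χ z p)
    Y p = χ z p ∧ not (χ w p)
    c : ℕ
    c = count (λ p → χ z p ∧ χ w p)
    ∣w∣ : c + count W ≡ k
    ∣w∣ = trans (cong (_+ count W) (count-∧-comm (χ z) (χ w)))
                (trans (sym (count-partition (χ w) (χ z))) (count-χ w))
    ∣z∣ : c + count Y ≡ k
    ∣z∣ = trans (sym (count-partition (χ z) (χ w))) (count-χ z)
    key : ∀ i → suc ∣ proj₁ z ∩ proj₁ (a i) ∣ ≡ c + (bit (W (removed (e i))) + bit (Y (added (e i))))
    key i rewrite ∣u∩v∣≡count z (a i) | removed∈w (e i) | added∉w (e i) | ∧-identityʳ (χ z (added (e i))) =
      bit-trade _ c _ _ (exchange-overlap (e i) (χ z))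

-- Five points of a grid

Distinct : (x y : Fin n → Fin m) → Set
Distinct x y = ∀ {i j} → i ≢ j → x i ≡ x j → y i ≡ y j → ⊥

collide : {x y : Fin n → Fin m} → Distinct x y →
          ∀ {s t X Y} → s ≢ t → x s ≡ X → y s ≡ Y → x t ≡ X → y t ≡ Y → ⊥
collide distinct s≢t xₛ yₛ xₜ yₜ = distinct s≢t (trans xₛ (sym xₜ)) (trans yₛ (sym yₜ))

GridTrace-transpose : {x y : Fin n → Fin m} {B : Fin n → Bool} → GridTrace x y B → GridTrace y x B
GridTrace-transpose (full B≡)          = full B≡
GridTrace-transpose {x = x} {y} (cross X Y B≡) =
  cross Y X λ i → trans (B≡ i) (xor-comm (x i == X) (y i == Y))
GridTrace-transpose {x = x} {y} (box W Y W₂ Y₂ B≡) =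
  box Y W Y₂ W₂ λ i → trans (B≡ i) (∧-comm (W (x i)) (Y (y i)))
GridTrace-transpose (empty B≡)         = empty B≡

allBut : Fin n → Fin n → Bool
allBut j t = not (t == j)

allBut-self : (j : Fin n) → allBut j j ≡ false
allBut-self j rewrite ==-refl j = refl

allBut-other : {j t : Fin n} → t ≢ j → allBut j t ≡ true
allBut-other t≢j rewrite ≢⇒==false t≢j = refl

-- Let i and l span a rectangle. The trace missing a third point j is then a cross centred at one
-- of the two other corners, or a box all of whose other points lie on those two corners.
module NonAligned {x y : Fin n → Fin m} (distinct : Distinct x y)
                  {i l : Fin n} (xᵢ≢xₗ : x i ≢ x l) (yᵢ≢yₗ : y i ≢ y l) where

  Corner : Fin n → Set
  Corner t = (x t ≡ x i × y t ≡ y l) ⊎ (x t ≡ x l × y t ≡ y i)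

  CrossAt : Fin m → Fin m → Fin n → Set
  CrossAt X Y j = ∀ t → allBut j t ≡ ((x t == X) xor (y t == Y))

  Outside : Fin n → Set
  Outside t = t ≢ i × t ≢ l

  BoxedAt : Fin n → Set
  BoxedAt j = ∀ t → t ≢ j → Outside t → Corner t

  data Shape (j : Fin n) : Set where
    centred₁ : CrossAt (x i) (y l) j → Shape j
    centred₂ : CrossAt (x l) (y i) j → Shape j
    boxed    : BoxedAt j → Shape j

  shape : {j : Fin n} → Outside j → GridTrace x y (allBut j) → Shape j
  shape {j} _ (full B≡)  with trans (sym (allBut-self j)) (B≡ j)
  ... | ()
  shape {j} (j≢i , j≢l) (empty B≡) with trans (sym (allBut-other (j≢i ∘ sym))) (B≡ i)
  ... | ()
  shape {j} (j≢i , j≢l) (cross X Y B≡)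
    with xor-true (trans (sym (B≡ i)) (allBut-other (j≢i ∘ sym))) | xor-true (trans (sym (B≡ l)) (allBut-other (j≢l ∘ sym)))
  ... | inj₁ (xᵢ=X , _) | inj₁ (xₗ=X , _) = ⊥-elim (xᵢ≢xₗ (trans (==⇒≡ xᵢ=X) (sym (==⇒≡ xₗ=X))))
  ... | inj₁ (xᵢ=X , _) | inj₂ (_ , yₗ=Y) =
    centred₁ (subst₂ (λ X Y → CrossAt X Y j) (sym (==⇒≡ xᵢ=X)) (sym (==⇒≡ yₗ=Y)) B≡)
  ... | inj₂ (_ , yᵢ=Y) | inj₁ (xₗ=X , _) =
    centred₂ (subst₂ (λ X Y → CrossAt X Y j) (sym (==⇒≡ xₗ=X)) (sym (==⇒≡ yᵢ=Y)) B≡)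
  ... | inj₂ (_ , yᵢ=Y) | inj₂ (_ , yₗ=Y) = ⊥-elim (yᵢ≢yₗ (trans (==⇒≡ yᵢ=Y) (sym (==⇒≡ yₗ=Y))))
  shape {j} (j≢i , j≢l) (box W Y W₂ Y₂ B≡) = boxed corner
    where
    inside : ∀ {t} → t ≢ j → W (x t) ≡ true × Y (y t) ≡ true
    inside t≢j = ∧-true (trans (sym (B≡ _)) (allBut-other t≢j))
    corner : BoxedAt j
    corner t t≢j (t≢i , t≢l)
      with W₂ (x i) (x l) (x t) (proj₁ (inside (j≢i ∘ sym))) (proj₁ (inside (j≢l ∘ sym))) (proj₁ (inside t≢j)) xᵢ≢xₗ
         | Y₂ (y i) (y l) (y t) (proj₂ (inside (j≢i ∘ sym))) (proj₂ (inside (j≢l ∘ sym))) (proj₂ (inside t≢j)) yᵢ≢yₗ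
    ... | inj₁ xᵢ≡xₜ | inj₁ yᵢ≡yₜ = ⊥-elim (distinct t≢i (sym xᵢ≡xₜ) (sym yᵢ≡yₜ))
    ... | inj₁ xᵢ≡xₜ | inj₂ yₗ≡yₜ = inj₁ (sym xᵢ≡xₜ , sym yₗ≡yₜ)
    ... | inj₂ xₗ≡xₜ | inj₁ yᵢ≡yₜ = inj₂ (sym xₗ≡xₜ , sym yᵢ≡yₜ)
    ... | inj₂ xₗ≡xₜ | inj₂ yₗ≡yₜ = ⊥-elim (distinct t≢l (sym xₗ≡xₜ) (sym yₗ≡yₜ))

  three-corners : {a b c : Fin n} → a ≢ b → a ≢ c → b ≢ c → Corner a → Corner b → Corner c → ⊥
  three-corners a≢b _   _   (inj₁ (xa , ya)) (inj₁ (xb , yb)) _ = collide distinct a≢b xa ya xb yb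
  three-corners a≢b _   _   (inj₂ (xa , ya)) (inj₂ (xb , yb)) _ = collide distinct a≢b xa ya xb yb
  three-corners _   a≢c _   (inj₁ (xa , ya)) (inj₂ _) (inj₁ (xc , yc)) = collide distinct a≢c xa ya xc yc
  three-corners _   a≢c _   (inj₂ (xa , ya)) (inj₁ _) (inj₂ (xc , yc)) = collide distinct a≢c xa ya xc yc
  three-corners _   _   b≢c (inj₁ _) (inj₂ (xb , yb)) (inj₂ (xc , yc)) = collide distinct b≢c xb yb xc yc
  three-corners _   _   b≢c (inj₂ _) (inj₁ (xb , yb)) (inj₁ (xc , yc)) = collide distinct b≢c xb yb xc yc

  cross₁-misses-corners : ∀ {t} → Corner t → ((x t == x i) xor (y t == y l)) ≡ false
  cross₁-misses-corners (inj₁ (xₜ , yₜ)) rewrite xₜ | yₜ | ==-refl (x i) | ==-refl (y l) = refl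
  cross₁-misses-corners (inj₂ (xₜ , yₜ))
    rewrite xₜ | yₜ | ≢⇒==false (xᵢ≢xₗ ∘ sym) | ≢⇒==false yᵢ≢yₗ = refl

  cross₂-misses-corners : ∀ {t} → Corner t → ((x t == x l) xor (y t == y i)) ≡ false
  cross₂-misses-corners (inj₁ (xₜ , yₜ))
    rewrite xₜ | yₜ | ≢⇒==false xᵢ≢xₗ | ≢⇒==false (yᵢ≢yₗ ∘ sym) = refl
  cross₂-misses-corners (inj₂ (xₜ , yₜ)) rewrite xₜ | yₜ | ==-refl (x l) | ==-refl (y i) = refl

  same-cross : ∀ {X Y j j′} → j ≢ j′ → CrossAt X Y j → CrossAt X Y j′ → ⊥
  same-cross {j′ = j′} j≢j′ cj cj′
    with trans (sym (allBut-other (j≢j′ ∘ sym))) (trans (cj j′) (trans (sym (cj′ j′)) (allBut-self j′)))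
  ... | ()

  -- If a is boxed, the two other outside points b and c occupy both corners.
  boxed-excludes : ∀ {a b c} → a ≢ b → a ≢ c → b ≢ c → Outside a → Outside b → Outside c →
                   BoxedAt a → Shape b → ⊥
  boxed-excludes a≢b a≢c b≢c _ oᵇ oᶜ boxedₐ (centred₁ crossᵇ)
    with trans (sym (allBut-other (b≢c ∘ sym))) (trans (crossᵇ _) (cross₁-misses-corners (boxedₐ _ (a≢c ∘ sym) oᶜ)))
  ... | ()
  boxed-excludes a≢b a≢c b≢c _ oᵇ oᶜ boxedₐ (centred₂ crossᵇ)
    with trans (sym (allBut-other (b≢c ∘ sym))) (trans (crossᵇ _) (cross₂-misses-corners (boxedₐ _ (a≢c ∘ sym) oᶜ)))
  ... | ()
  boxed-excludes a≢b a≢c b≢c oᵃ oᵇ oᶜ boxedₐ (boxed boxedᵇ) =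
    three-corners a≢b a≢c b≢c (boxedᵇ _ a≢b oᵃ) (boxedₐ _ (a≢b ∘ sym) oᵇ) (boxedₐ _ (a≢c ∘ sym) oᶜ)

  three-outside-shapes : ∀ {a b c} → a ≢ b → a ≢ c → b ≢ c → Outside a → Outside b → Outside c →
                         Shape a → Shape b → Shape c → ⊥
  three-outside-shapes a≢b a≢c b≢c oᵃ oᵇ oᶜ = go
    where
    go : Shape _ → Shape _ → Shape _ → ⊥
    go (boxed bₐ) sᵇ _ = boxed-excludes a≢b a≢c b≢c oᵃ oᵇ oᶜ bₐ sᵇ
    go sᵃ (boxed bᵇ) _ = boxed-excludes (a≢b ∘ sym) b≢c a≢c oᵇ oᵃ oᶜ bᵇ sᵃ
    go sᵃ _ (boxed bᶜ) = boxed-excludes (a≢c ∘ sym) (b≢c ∘ sym) a≢b oᶜ oᵃ oᵇ bᶜ sᵃ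
    go (centred₁ cᵃ) (centred₁ cᵇ) _ = same-cross a≢b cᵃ cᵇ
    go (centred₂ cᵃ) (centred₂ cᵇ) _ = same-cross a≢b cᵃ cᵇ
    go (centred₁ cᵃ) _ (centred₁ cᶜ) = same-cross a≢c cᵃ cᶜ
    go (centred₂ cᵃ) _ (centred₂ cᶜ) = same-cross a≢c cᵃ cᶜ
    go (centred₁ _) (centred₂ cᵇ) (centred₂ cᶜ) = same-cross b≢c cᵇ cᶜ
    go (centred₂ _) (centred₁ cᵇ) (centred₁ cᶜ) = same-cross b≢c cᵇ cᶜ

first-three : Fin 5 → Bool
first-three 0F = true
first-three 1F = true
first-three 2F = true
first-three 3F = false
first-three 4F = false

collinear-misses-first-three : {x y : Fin 5 → Fin m} → Distinct x y → (∀ t → x t ≡ x 0F) →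
                               ¬ GridTrace x y first-three
collinear-misses-first-three _ _ (full B≡) with B≡ 3F
... | ()
collinear-misses-first-three _ _ (empty B≡) with B≡ 0F
... | ()
collinear-misses-first-three {x = x} {y} distinct x≡x₀ (cross X Y B≡) with x 0F == X in x₀=X
... | true  = collide distinct {3F} {4F} (λ ()) (x≡x₀ 3F) (==⇒≡ (on-column 3F refl)) (x≡x₀ 4F) (==⇒≡ (on-column 4F refl))
  where
  on-column : ∀ t → first-three t ≡ false → (y t == Y) ≡ true
  on-column t excluded = trans (sym (not-involutive _)) (cong not (sym (begin
    false                            ≡⟨ excluded ⟨
    first-three t                    ≡⟨ B≡ t ⟩
    (x t == X) xor (y t == Y)         ≡⟨ cong (λ b → (b == X) xor (y t == Y)) (x≡x₀ t) ⟩
    (x 0F == X) xor (y t == Y)        ≡⟨ cong (_xor (y t == Y)) x₀=X ⟩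
    not (y t == Y)                   ∎)))
    where open ≡-Reasoning
... | false = collide distinct {0F} {1F} (λ ()) (x≡x₀ 0F) (==⇒≡ (on-column 0F refl)) (x≡x₀ 1F) (==⇒≡ (on-column 1F refl))
  where
  on-column : ∀ t → first-three t ≡ true → (y t == Y) ≡ true
  on-column t included = begin
    y t == Y                         ≡⟨ cong (_xor (y t == Y)) x₀=X ⟨
    (x 0F == X) xor (y t == Y)        ≡⟨ cong (λ b → (b == X) xor (y t == Y)) (x≡x₀ t) ⟨
    (x t == X) xor (y t == Y)         ≡⟨ B≡ t ⟨
    first-three t                    ≡⟨ included ⟩
    true                             ∎
    where open ≡-Reasoning
collinear-misses-first-three {x = x} {y} distinct x≡x₀ (box W Y _ Y₂ B≡)
  with Y₂ (y 0F) (y 1F) (y 2F) (in-Y 0F refl) (in-Y 1F refl) (in-Y 2F refl)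
          (distinct {0F} {1F} (λ ()) (trans (x≡x₀ 0F) (sym (x≡x₀ 1F))))
  where
  in-Y : ∀ t → first-three t ≡ true → Y (y t) ≡ true
  in-Y t included = proj₂ (∧-true (trans (sym (B≡ t)) included))
... | inj₁ y₀≡y₂ = distinct {0F} {2F} (λ ()) (trans (x≡x₀ 0F) (sym (x≡x₀ 2F))) y₀≡y₂
... | inj₂ y₁≡y₂ = distinct {1F} {2F} (λ ()) (trans (x≡x₀ 1F) (sym (x≡x₀ 2F))) y₁≡y₂

Distinct-transpose : {x y : Fin n → Fin m} → Distinct x y → Distinct y x
Distinct-transpose distinct i≢j yᵢ≡yⱼ xᵢ≡xⱼ = distinct i≢j xᵢ≡xⱼ yᵢ≡yⱼ

row-through-aligned-pair : {x y : Fin n → Fin m} → Distinct x y → {i j : Fin n} → i ≢ j → x i ≡ x j →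
  (∀ t → x i ≡ x t ⊎ y i ≡ y t) → (∀ t → x j ≡ x t ⊎ y j ≡ y t) → ∀ t → x t ≡ x i
row-through-aligned-pair distinct i≢j xᵢ≡xⱼ alignedᵢ alignedⱼ t with alignedᵢ t | alignedⱼ t
... | inj₁ xᵢ≡xₜ | _          = sym xᵢ≡xₜ
... | inj₂ _     | inj₁ xⱼ≡xₜ = trans (sym xⱼ≡xₜ) (sym xᵢ≡xⱼ)
... | inj₂ yᵢ≡yₜ | inj₂ yⱼ≡yₜ = ⊥-elim (distinct i≢j xᵢ≡xⱼ (trans yᵢ≡yₜ (sym yⱼ≡yₜ)))

module _ {x y : Fin 5 → Fin m} (distinct : Distinct x y) (allBut-traces : ∀ j → GridTrace x y (allBut j)) where

  Aligned : Fin 5 → Fin 5 → Set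
  Aligned i l = x i ≡ x l ⊎ y i ≡ y l

  aligned : ∀ i l a b c {_ : True (UniqueDec.unique? Fin._≟_ (i ∷ l ∷ a ∷ b ∷ c ∷ []))} → Aligned i l
  aligned i l a b c {five-distinct} with x i Fin.≟ x l | y i Fin.≟ y l
  ... | yes xᵢ≡xₗ | _         = inj₁ xᵢ≡xₗ
  ... | no _      | yes yᵢ≡yₗ = inj₂ yᵢ≡yₗ
  ... | no xᵢ≢xₗ  | no yᵢ≢yₗ  with toWitness five-distinct
  ...   | (_ ∷ i≢a ∷ i≢b ∷ i≢c ∷ []) ∷ (l≢a ∷ l≢b ∷ l≢c ∷ []) ∷ (a≢b ∷ a≢c ∷ []) ∷ (b≢c ∷ []) ∷ [] ∷ [] =
    ⊥-elim (three-outside-shapes a≢b a≢c b≢c oᵃ oᵇ oᶜ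
              (shape oᵃ (allBut-traces a)) (shape oᵇ (allBut-traces b)) (shape oᶜ (allBut-traces c)))
    where
    open NonAligned distinct xᵢ≢xₗ yᵢ≢yₗ
    oᵃ = (i≢a ∘ sym , l≢a ∘ sym)
    oᵇ = (i≢b ∘ sym , l≢b ∘ sym)
    oᶜ = (i≢c ∘ sym , l≢c ∘ sym)

  aligned-with-0F : ∀ t → Aligned 0F t
  aligned-with-0F 0F = inj₁ refl
  aligned-with-0F 1F = aligned 0F 1F 2F 3F 4F
  aligned-with-0F 2F = aligned 0F 2F 1F 3F 4F
  aligned-with-0F 3F = aligned 0F 3F 1F 2F 4F
  aligned-with-0F 4F = aligned 0F 4F 1F 2F 3F

  aligned-with-1F : ∀ t → Aligned 1F t
  aligned-with-1F 0F = aligned 1F 0F 2F 3F 4F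
  aligned-with-1F 1F = inj₁ refl
  aligned-with-1F 2F = aligned 1F 2F 0F 3F 4F
  aligned-with-1F 3F = aligned 1F 3F 0F 2F 4F
  aligned-with-1F 4F = aligned 1F 4F 0F 2F 3F

  collinear : (∀ t → x t ≡ x 0F) ⊎ (∀ t → y t ≡ y 0F)
  collinear with aligned-with-0F 1F
  ... | inj₁ x₀≡x₁ = inj₁ (row-through-aligned-pair distinct (λ ()) x₀≡x₁ aligned-with-0F aligned-with-1F)
  ... | inj₂ y₀≡y₁ = inj₂ (row-through-aligned-pair (Distinct-transpose distinct) (λ ()) y₀≡y₁
                             (Sum.swap ∘ aligned-with-0F) (Sum.swap ∘ aligned-with-1F))

  five-points-miss-first-three : ¬ GridTrace x y first-three
  five-points-miss-first-three trace with collinear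
  ... | inj₁ row = collinear-misses-first-three distinct row trace
  ... | inj₂ col = collinear-misses-first-three (Distinct-transpose distinct) col (GridTrace-transpose trace)

-- The VC-dimension of J(m,k)

Johnson-cannot-shatter-5 : {p : Fin 5 → JVertex m k} → ¬ Shatters (Johnson m k) p
Johnson-cannot-shatter-5 {p = p} shatters =
  five-points-miss-first-three distinct (trace ∘ allBut) (trace first-three)
  where
  w = proj₁ (shatters (λ _ → true))
  exchange : ∀ i → Exchange w (p i)
  exchange i = adjacent⇒exchange w (p i) (Equivalence.from (proj₂ (shatters (λ _ → true)) i) refl)
  trace : ∀ B → GridTrace (Exchange.removed ∘ exchange) (Exchange.added ∘ exchange) B
  trace B = trace-is-GridTrace exchange (proj₁ (shatters B)) B (proj₂ (shatters B))
  distinct : Distinct (Exchange.removed ∘ exchange) (Exchange.added ∘ exchange)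
  distinct i≢j removedᵢ≡removedⱼ addedᵢ≡addedⱼ =
    shatters-injective (Johnson _ _) shatters i≢j (exchange-determined (exchange _) (exchange _) removedᵢ≡removedⱼ addedᵢ≡addedⱼ)

Johnson-shatters⇒n≤4 : {p : Fin n → JVertex m k} → Shatters (Johnson m k) p → n ≤ 4
Johnson-shatters⇒n≤4 {n} {m} {k} {p} shatters with n ℕ.≤? 4
... | yes n≤4 = n≤4
... | no  n≰4 with m≤n⇒∃[o]m+o≡n (≰⇒> n≰4)
...   | r , refl = ⊥-elim (Johnson-cannot-shatter-5 {p = p ∘ (_↑ˡ r)} (shatters-↑ˡ (Johnson m k) {k = 5} {p = p} shatters))

Johnson-shattered-by-search : (m k : ℕ) (A : List (JVertex m k)) →
  {_ : True (search? (Johnson m k) Johnson-adj? (kSubsets m k) (List.lookup A))} →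
  Shattered (Johnson m k) A
Johnson-shattered-by-search m k A {found} = shatters⇒Shattered (Johnson m k) A
  (shatters-by-search (Johnson m k) Johnson-adj? (kSubsets m k) (List.lookup A) (toWitness found))

J-6-3-shattered : Shattered (Johnson 6 3)
  ( (true ∷ true  ∷ true  ∷ false ∷ false ∷ false ∷ [] , refl)
  ∷ (true ∷ true  ∷ false ∷ true  ∷ false ∷ false ∷ [] , refl)
  ∷ (true ∷ false ∷ true  ∷ false ∷ true  ∷ false ∷ [] , refl)
  ∷ (true ∷ false ∷ false ∷ true  ∷ false ∷ true  ∷ [] , refl)
  ∷ [])
J-6-3-shattered = Johnson-shattered-by-search 6 3 _

J-7-2-shattered : Shattered (Johnson 7 2)
  ( (true ∷ true  ∷ false ∷ false ∷ false ∷ false ∷ false ∷ [] , refl)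
  ∷ (true ∷ false ∷ true  ∷ false ∷ false ∷ false ∷ false ∷ [] , refl)
  ∷ (true ∷ false ∷ false ∷ true  ∷ false ∷ false ∷ false ∷ [] , refl)
  ∷ (true ∷ false ∷ false ∷ false ∷ true  ∷ false ∷ false ∷ [] , refl)
  ∷ [])
J-7-2-shattered = Johnson-shattered-by-search 7 2 _

J-7-5-shattered : Shattered (Johnson 7 5)
  ( (true ∷ true ∷ true  ∷ true  ∷ true  ∷ false ∷ false ∷ [] , refl)
  ∷ (true ∷ true ∷ true  ∷ true  ∷ false ∷ true  ∷ false ∷ [] , refl)
  ∷ (true ∷ true ∷ true  ∷ false ∷ true  ∷ true  ∷ false ∷ [] , refl)
  ∷ (true ∷ true ∷ false ∷ true  ∷ true  ∷ true  ∷ false ∷ [] , refl)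
  ∷ [])
J-7-5-shattered = Johnson-shattered-by-search 7 5 _

HasShattered4 : ℕ → ℕ → Set
HasShattered4 m k = Σ (Fin 4 → JVertex m k) (Shatters (Johnson m k))

pad-HasShattered4 : (a b : ℕ) → HasShattered4 n k → HasShattered4 (n + (a + b)) (k + a)
pad-HasShattered4 {n} {k} a b (p , shatters) =
  pad e ∣e∣≡a ∘ p ,
  shatters-embed {H = Johnson n k} {G = Johnson (n + (a + b)) (k + a)} (pad e ∣e∣≡a) (pad-adj e ∣e∣≡a) {p = p} shatters
  where
  e : Subset (a + b)
  e = Subset.⊤ {a} Vec.++ Subset.⊥ {b}
  ∣e∣≡a : ∣ e ∣ ≡ a
  ∣e∣≡a = trans (∣p++q∣≡∣p∣+∣q∣ (Subset.⊤ {a}) (Subset.⊥ {b}))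
                (trans (cong₂ _+_ (∣⊤∣≡n a) (∣⊥∣≡0 b)) (+-identityʳ a))

Shattered⇒HasShattered4 : (A : List (JVertex m k)) → Shattered (Johnson m k) A → List.length A ≡ 4 → HasShattered4 m k
Shattered⇒HasShattered4 A@(_ ∷ _ ∷ _ ∷ _ ∷ []) (_ , shatters) refl = List.lookup A , shatters

-- The five interior cases not reached from J(6,3), J(7,2), J(7,5) have fewer than 16 vertices.
HasShattered4-by-padding : (j d : ℕ) → 16 ≤ (4 + j + d) C (2 + j) → HasShattered4 (4 + j + d) (2 + j)
HasShattered4-by-padding 0 0 few = contradiction few (from-no (16 ℕ.≤? 4 C 2))
HasShattered4-by-padding 0 1 few = contradiction few (from-no (16 ℕ.≤? 5 C 2))
HasShattered4-by-padding 0 2 few = contradiction few (from-no (16 ℕ.≤? 6 C 2))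
HasShattered4-by-padding 1 0 few = contradiction few (from-no (16 ℕ.≤? 5 C 3))
HasShattered4-by-padding 2 0 few = contradiction few (from-no (16 ℕ.≤? 6 C 4))
HasShattered4-by-padding 0 (suc (suc (suc d))) _ = pad-HasShattered4 0 d (Shattered⇒HasShattered4 _ J-7-2-shattered refl)
HasShattered4-by-padding (suc (suc (suc j))) 0 _ = pad-HasShattered4 j 0 (Shattered⇒HasShattered4 _ J-7-5-shattered refl)
HasShattered4-by-padding (suc j) (suc d) _ =
  subst (λ n → HasShattered4 (5 + n) (3 + j)) (sym (+-suc j d))
        (pad-HasShattered4 j d (Shattered⇒HasShattered4 _ J-6-3-shattered refl))

HasShattered4⇒interior : k ≤ m → HasShattered4 m k → 1 < k × k < m ∸ 1
HasShattered4⇒interior {0} _ (p , shatters) = ⊥-elim (edgeless-shatters-nothing (Johnson _ _) (λ u v ()) {p = p} shatters)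
HasShattered4⇒interior {1} _ (p , shatters) =
  ⊥-elim (complete-shatters-at-most-one (Johnson _ _) Johnson-m-1-complete {p = p} shatters)
HasShattered4⇒interior {suc (suc j)} k≤m (p , shatters) with m≤n⇒∃[o]m+o≡n k≤m
... | 0 , k+0≡m =
  ⊥-elim (edgeless-shatters-nothing (Johnson _ _) (Johnson-k≡m-edgeless (trans (sym (+-identityʳ _)) k+0≡m)) {p = p} shatters)
... | 1 , k+1≡m =
  ⊥-elim (complete-shatters-at-most-one (Johnson _ _) (Johnson-1+k≡m-complete (trans (+-comm 1 _) k+1≡m)) {p = p} shatters)
... | suc (suc d) , refl =
  s≤s (s≤s z≤n) , s≤s (begin
    2 + j           ≤⟨ s≤s (s≤s (m≤m+n j d)) ⟩
    2 + (j + d)     ≡⟨ cong suc (+-suc j d) ⟨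
    1 + (j + suc d) ≡⟨ +-suc j (suc d) ⟨
    j + (2 + d)     ∎)
  where open ≤-Reasoning

interior⇒HasShattered4 : 1 < k → k < m ∸ 1 → 16 ≤ m C k → HasShattered4 m k
interior⇒HasShattered4 {suc (suc j)} {suc m′} (s≤s (s≤s _)) k<m′ enough with m≤n⇒∃[o]m+o≡n k<m′
... | d , refl = HasShattered4-by-padding j d enough

HasShattered4⇒Shattered : HasShattered4 m k → ∃ λ A → Shattered (Johnson m k) A × List.length A ≡ 4
HasShattered4⇒Shattered (p , shatters) = List.tabulate p , shatters⇒Shattered-tabulate (Johnson _ _) p shatters , refl

mainTheorem2 : (m k : ℕ) → k ≤ m →
    VCdimEq (Johnson m k) 4 ⇔ ((1 < k × k < m ∸ 1) × 16 ≤ m C k)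
mainTheorem2 m k k≤m = mk⇔
  (λ ((A , shattered , ∣A∣≡4) , _) →
     let p , shatters = Shattered⇒HasShattered4 A shattered ∣A∣≡4 in
     HasShattered4⇒interior k≤m (p , shatters) , Johnson-shatters⇒2^n≤mCk {p = p} shatters)
  (λ ((1<k , k<m∸1) , enough) →
     HasShattered4⇒Shattered (interior⇒HasShattered4 1<k k<m∸1 enough) ,
     λ A shattered → Johnson-shatters⇒n≤4 {p = List.lookup A} (proj₂ shattered))
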